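{- Let $\sigma$ be a D-permutation of $[2n]$, let $F=\{2,4,\dots,2n\}$, $G=\{1,3,\dots,2n-1\}$, $F'=\{i:\sigma^{ -1}(i)\text{ even}\}=\{y_1<\dots<y_n\}$, and let $j$ with $1\le j\le n$ be such that $y_j\in G\cap F'$ (i.e. $y_j$ is a cycle valley of $\sigma$). Then \[ \#\{u\in F\setminus\{\sigma^{ -1}(y_n),\dots,\sigma^{ -1}(y_{j+1})\}:u>y_j\}=\lceil h_{y_j-1}/2\rceil+1=\lceil(h_{y_j}+1)/2\rceil=f_{y_j}, \] where $h_i$ is the height after step $i$ of the almost-Dyck path of $\sigma$ and $f_k=\#\{i\le k:\sigma(i)>k\}$.
   Context: A D-permutation of $[2n]$ is a permutation $\sigma$ with $\sigma(2k-1)\ge2k-1$ and $\sigma(2k)\le2k$ for all $k$. The almost-Dyck path of $\sigma$ has steps $s_1,\dots,s_{2n}$ starting at height $h_0=0$: $s_i$ is a rise (height $+1$) if $\sigma^{ -1}(i)$ is even and a fall (height $-1$) if $\sigma^{ -1}(i)$ is odd; $h_i$ is the height after step $i$. A cycle valley is an index $i$ with $\sigma^{ -1}(i)>i<\sigma(i)$. -}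

module Defs where

open import Data.Nat using (ℕ; zero; suc; _+_; _*_; _≤_; _<_; _≤ᵇ_; _<ᵇ_; _/_)
open import Data.Bool using (Bool; true; false; not; _∧_; if_then_else_)
open import Data.Fin using (Fin; toℕ; _≟_)
open import Data.Fin.Permutation using (Permutation′; _⟨$⟩ʳ_; _⟨$⟩ˡ_)
open import Data.List using (List; filter; length; allFin; map)
open import Data.Bool.ListAction using (any)
open import Data.Integer using (ℤ; +_; -[1+_]; -_)
import Data.Integer as ℤ
open import Relation.Nullary.Decidable using (⌊_⌋)
open import Relation.Binary.PropositionalEquality using (_≡_)

-- Convention: an element i : Fin (2n) stands for the integer pos i = toℕ i + 1 ∈ [2n].
pos : ∀ {m} → Fin m → ℕ
pos i = suc (toℕ i)

evenᵇ : ℕ → Bool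
evenᵇ zero = true
evenᵇ (suc k) = not (evenᵇ k)

IsDPerm : ∀ n → Permutation′ (2 * n) → Set
IsDPerm n σ = ∀ (i : Fin (2 * n)) →
  (evenᵇ (pos i) ≡ false → pos i ≤ pos (σ ⟨$⟩ʳ i)) ×' (evenᵇ (pos i) ≡ true → pos (σ ⟨$⟩ʳ i) ≤ pos i)
  where
  open import Data.Product using () renaming (_×_ to _×'_)

count : ∀ {m} → (Fin m → Bool) → ℕ
count {m} p = length (filter (λ i → p i Data.Bool.≟ true) (allFin m))
  where import Data.Bool

inF : ∀ {m} → Fin m → Bool
inF i = evenᵇ (pos i)

inG : ∀ {m} → Fin m → Bool
inG i = not (evenᵇ (pos i))

inF′ : ∀ n → Permutation′ (2 * n) → Fin (2 * n) → Bool
inF′ n σ i = evenᵇ (pos (σ ⟨$⟩ˡ i))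

step : ∀ n → Permutation′ (2 * n) → Fin (2 * n) → ℤ
step n σ i = if inF′ n σ i then + 1 else - (+ 1)

sumℤ : List ℤ → ℤ
sumℤ = Data.List.foldr ℤ._+_ (+ 0)
  where import Data.List

-- height h_k after step k (h_0 = 0), k ∈ {0,...,2n}
height : ∀ n → Permutation′ (2 * n) → ℕ → ℤ
height n σ k = sumℤ (map (step n σ) (filter (λ i → pos i Data.Nat.≤? k) (allFin (2 * n))))
  where import Data.Nat

ceilHalf : ℤ → ℤ
ceilHalf (+ m) = + ((m + 1) / 2)
ceilHalf -[1+ m ] = - (+ ((suc m) / 2))

fcount : ∀ n → Permutation′ (2 * n) → ℕ → ℕ
fcount n σ k = count (λ i → (pos i ≤ᵇ k) ∧ (k <ᵇ pos (σ ⟨$⟩ʳ i)))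

-- u ∈ {σ⁻¹(y') : y' ∈ F', y' > y}  (i.e. u ∈ {σ⁻¹(y_n),…,σ⁻¹(y_{j+1})} when y = y_j)
inLaterPreimages : ∀ n → Permutation′ (2 * n) → Fin (2 * n) → Fin (2 * n) → Bool
inLaterPreimages n σ y u =
  any (λ y′ → inF′ n σ y′ ∧ (pos y <ᵇ pos y′) ∧ ⌊ σ ⟨$⟩ˡ y′ ≟ u ⌋) (allFin (2 * n))

lhsCount : ∀ n → Permutation′ (2 * n) → Fin (2 * n) → ℕ
lhsCount n σ y = count (λ u → inF u ∧ not (inLaterPreimages n σ y u) ∧ (pos y <ᵇ pos u))

-- Fix k = y_j (odd) and let U = f_k = #{i ≤ k : σ(i) > k}, D = #{i > k : σ(i) ≤ k}; since σ is a
-- permutation of [2n], U = D. Up to k the path has R_k rises and F_k falls, so h_k = R_k − F_k.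
-- The D-permutation inequalities force every even i ≤ k to have σ(i) ≤ k and every odd i > k to
-- have σ(i) > k; reading off the preimages of the values ≤ k gives R_k = #{even i ≤ k} + D and
-- #{odd i ≤ k} = F_k + U. As k is odd there is one more odd than even number up to k, hence
-- h_k + 1 = 2U, and h_{k−1} = h_k − 1 because step k is a rise (y_j ∈ F′). Finally an even u is
-- σ⁻¹(y′) for some y′ ∈ F′ with y′ > k exactly when σ(u) > k, so the left-hand count is
-- #{even u > k : σ(u) ≤ k} = D.
module Submission where

open import Defs
open import Data.Nat using (ℕ)
open import Data.Bool using (true)
open import Data.Fin using (Fin; toℕ)
open import Data.Fin.Permutation using (Permutation′)
open import Data.Integer using (ℤ; +_; _+_)
open import Data.Product using (_×_)
open import Relation.Binary.PropositionalEquality using (_≡_)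

import Algebra.Properties.CommutativeMonoid.Sum as Sum
open import Data.Bool using (Bool; false; not; _∧_; _∨_; if_then_else_; T)
import Data.Bool as Bool
open import Data.Bool.ListAction using (any)
open import Data.Bool.Properties using (T-≡; not-involutive; ∧-identityʳ; ∧-comm)
open import Data.Empty using (⊥-elim)
open import Data.Fin using (zero; suc; _≟_)
open import Data.Fin.Permutation using (_⟨$⟩ʳ_; _⟨$⟩ˡ_; inverseˡ; inverseʳ)
import Data.Fin.Properties as Fin
open import Data.Integer using (-_; -[1+_]; _-_)
import Data.Integer.Properties as ℤ
import Data.Integer.Solver as ℤSolver
open import Data.List using (List; filter; length; map; tabulate)
open import Data.List.Membership.Propositional using (_∈_; lose)
open import Data.List.Membership.Propositional.Properties using (∈-allFin)
open import Data.List.Relation.Unary.Any using (satisfied)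
open import Data.List.Relation.Unary.Any.Properties using (any⁺; any⁻)
open import Data.Nat using (zero; suc; _≤_; _<_; _≤ᵇ_; _<ᵇ_; _/_; z≤n; s≤s)
open import Data.Nat.Divisibility using (∣-refl)
open import Data.Nat.DivMod using (+-distrib-/-∣ʳ; m/n≡1+[m∸n]/n)
import Data.Nat as ℕ
import Data.Nat.Properties as ℕ
open import Data.Product using (_,_; proj₁; proj₂)
open import Data.Unit using (tt)
open import Function using (_∘_; id; Equivalence)
open import Relation.Binary.PropositionalEquality
  using (refl; sym; trans; cong; cong₂; subst; subst₂; module ≡-Reasoning)
open import Relation.Nullary using (yes; no; Dec; ofʸ; ofⁿ; contradiction)
open import Relation.Nullary.Decidable using (⌊_⌋; ⌊⌋-map′; isYes≗does; dec-true)

open Sum ℕ.+-0-commutativeMonoid using (sum; sum-cong-≗; ∑-distrib-+; sum-permute; sum-replicate-zero)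

indicator : Bool → ℕ
indicator true  = 1
indicator false = 0

≤ᵇ-true : ∀ {m n} → m ≤ n → (m ≤ᵇ n) ≡ true
≤ᵇ-true m≤n = Equivalence.to T-≡ (ℕ.≤⇒≤ᵇ m≤n)

≤ᵇ-false : ∀ {m n} → n < m → (m ≤ᵇ n) ≡ false
≤ᵇ-false {m} {n} n<m with m ≤ᵇ n | ℕ.≤ᵇ-reflects-≤ m n
... | true  | ofʸ m≤n = contradiction m≤n (ℕ.<⇒≱ n<m)
... | false | _       = refl

<ᵇ≡not-≤ᵇ : ∀ m n → (m <ᵇ n) ≡ not (n ≤ᵇ m)
<ᵇ≡not-≤ᵇ m n with m <ᵇ n | ℕ.<ᵇ-reflects-< m n | n ≤ᵇ m | ℕ.≤ᵇ-reflects-≤ n m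
... | true  | ofʸ m<n | true  | ofʸ n≤m = contradiction n≤m (ℕ.<⇒≱ m<n)
... | true  | _       | false | _       = refl
... | false | _       | true  | _       = refl
... | false | ofⁿ m≮n | false | ofⁿ n≰m = contradiction (ℕ.≰⇒> n≰m) m≮n

indicator-∨ˡ : ∀ a b → indicator (a ∨ b) ≡ indicator a ℕ.+ indicator (not a ∧ b)
indicator-∨ˡ true  _ = refl
indicator-∨ˡ false _ = refl

indicator-∨ʳ : ∀ a b → indicator (a ∨ b) ≡ indicator b ℕ.+ indicator (a ∧ not b)
indicator-∨ʳ true  true  = refl
indicator-∨ʳ true  false = refl
indicator-∨ʳ false true  = refl
indicator-∨ʳ false false = refl

length-filter-tabulate : ∀ {A : Set} {m} (p : A → Bool) (g : Fin m → A) →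
  length (filter (λ a → p a Bool.≟ true) (tabulate g)) ≡ sum (indicator ∘ p ∘ g)
length-filter-tabulate {m = zero}  p g = refl
length-filter-tabulate {m = suc m} p g with p (g zero)
... | true  = cong suc (length-filter-tabulate p (g ∘ suc))
... | false = length-filter-tabulate p (g ∘ suc)

count≡sum : ∀ {m} (p : Fin m → Bool) → count p ≡ sum (indicator ∘ p)
count≡sum p = length-filter-tabulate p id

count-suc : ∀ {m} (p : Fin (suc m) → Bool) → count p ≡ indicator (p zero) ℕ.+ count (p ∘ suc)
count-suc p = trans (count≡sum p) (cong (indicator (p zero) ℕ.+_) (sym (count≡sum (p ∘ suc))))

count-false : ∀ m → count {m} (λ _ → false) ≡ 0
count-false m = trans (count≡sum {m} (λ _ → false)) (sum-replicate-zero m)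

count-cong : ∀ {m} {p q : Fin m → Bool} → (∀ i → p i ≡ q i) → count p ≡ count q
count-cong {p = p} {q} p≗q = begin
  count p               ≡⟨ count≡sum p ⟩
  sum (indicator ∘ p)   ≡⟨ sum-cong-≗ (cong indicator ∘ p≗q) ⟩
  sum (indicator ∘ q)   ≡⟨ count≡sum q ⟨
  count q               ∎
  where open ≡-Reasoning

count-+ : ∀ {m} {p q r : Fin m → Bool} →
  (∀ i → indicator (p i) ≡ indicator (q i) ℕ.+ indicator (r i)) → count p ≡ count q ℕ.+ count r
count-+ {p = p} {q} {r} pointwise = begin
  count p                                         ≡⟨ count≡sum p ⟩
  sum (indicator ∘ p)                             ≡⟨ sum-cong-≗ pointwise ⟩
  sum (λ i → indicator (q i) ℕ.+ indicator (r i)) ≡⟨ ∑-distrib-+ (indicator ∘ q) (indicator ∘ r) ⟩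
  sum (indicator ∘ q) ℕ.+ sum (indicator ∘ r)     ≡⟨ cong₂ ℕ._+_ (count≡sum q) (count≡sum r) ⟨
  count q ℕ.+ count r                             ∎
  where open ≡-Reasoning

count-permute : ∀ {m} (π : Permutation′ m) (p : Fin m → Bool) → count (p ∘ (π ⟨$⟩ʳ_)) ≡ count p
count-permute π p = begin
  count (p ∘ (π ⟨$⟩ʳ_))           ≡⟨ count≡sum (p ∘ (π ⟨$⟩ʳ_)) ⟩
  sum (indicator ∘ p ∘ (π ⟨$⟩ʳ_)) ≡⟨ sum-permute (indicator ∘ p) π ⟨
  sum (indicator ∘ p)             ≡⟨ count≡sum p ⟨
  count p                         ∎
  where open ≡-Reasoning

count-singleton : ∀ {m} (p : Fin m → Bool) (y : Fin m) → count (λ i → ⌊ i ≟ y ⌋ ∧ p i) ≡ indicator (p y)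
count-singleton {suc m} p zero = begin
  count (λ i → ⌊ i ≟ zero ⌋ ∧ p i)              ≡⟨ count-suc (λ i → ⌊ i ≟ zero ⌋ ∧ p i) ⟩
  indicator (p zero) ℕ.+ count {m} (λ _ → false) ≡⟨ cong (indicator (p zero) ℕ.+_) (count-false m) ⟩
  indicator (p zero) ℕ.+ 0                       ≡⟨ ℕ.+-identityʳ _ ⟩
  indicator (p zero)                             ∎
  where open ≡-Reasoning
count-singleton {suc m} p (suc y) = begin
  count (λ i → ⌊ i ≟ suc y ⌋ ∧ p i)
    ≡⟨ count-suc (λ i → ⌊ i ≟ suc y ⌋ ∧ p i) ⟩
  count (λ i → ⌊ suc i ≟ suc y ⌋ ∧ p (suc i))
    ≡⟨ count-cong (λ i → cong (_∧ p (suc i)) (⌊⌋-map′ _ _ (i ≟ y))) ⟩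
  count (λ i → ⌊ i ≟ y ⌋ ∧ p (suc i))
    ≡⟨ count-singleton (p ∘ suc) y ⟩
  indicator (p (suc y))
    ∎
  where open ≡-Reasoning

count-prefix-step : ∀ {m} (p : Fin m → Bool) (y : Fin m) →
  count (λ i → (pos i ≤ᵇ pos y) ∧ p i) ≡ count (λ i → (pos i ≤ᵇ toℕ y) ∧ p i) ℕ.+ indicator (p y)
count-prefix-step p y =
  trans (count-+ pointwise) (cong (count (λ i → (pos i ≤ᵇ toℕ y) ∧ p i) ℕ.+_) (count-singleton p y))
  where
  pointwise : ∀ i → indicator ((pos i ≤ᵇ pos y) ∧ p i)
                  ≡ indicator ((pos i ≤ᵇ toℕ y) ∧ p i) ℕ.+ indicator (⌊ i ≟ y ⌋ ∧ p i)
  pointwise i with i ≟ y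
  ... | yes refl rewrite ≤ᵇ-true (ℕ.≤-refl {pos y}) | ≤ᵇ-false (ℕ.n<1+n (toℕ y)) = refl
  ... | no i≢y with pos i ℕ.≤? toℕ y
  ...   | yes i≤y rewrite ≤ᵇ-true i≤y | ≤ᵇ-true (ℕ.m≤n⇒m≤1+n i≤y) = sym (ℕ.+-identityʳ _)
  ...   | no i≰y rewrite ≤ᵇ-false {pos i} {toℕ y} (ℕ.≰⇒> i≰y)
                       | ≤ᵇ-false {pos i} {pos y} (s≤s (ℕ.≤∧≢⇒< (ℕ.≤-pred (ℕ.≰⇒> i≰y))
                                                              (i≢y ∘ Fin.toℕ-injective ∘ sym)))
                       = refl

odds≡evens+oddity : ∀ {m} k → k ≤ m →
  count {m} (λ i → (pos i ≤ᵇ k) ∧ not (evenᵇ (pos i)))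
    ≡ count {m} (λ i → (pos i ≤ᵇ k) ∧ evenᵇ (pos i)) ℕ.+ indicator (not (evenᵇ k))
odds≡evens+oddity {m} zero _ = sym (ℕ.+-identityʳ (count {m} (λ _ → false)))
odds≡evens+oddity {suc m} (suc k) (s≤s k≤m) = begin
  count {suc m} (λ i → (pos i ≤ᵇ suc k) ∧ not (evenᵇ (pos i)))
    ≡⟨ count-suc {m} (λ i → (pos i ≤ᵇ suc k) ∧ not (evenᵇ (pos i))) ⟩
  suc (count {m} (λ i → (pos i ≤ᵇ k) ∧ not (not (evenᵇ (pos i)))))
    ≡⟨ cong suc (count-cong {m} (λ i → cong ((pos i ≤ᵇ k) ∧_) (not-involutive (evenᵇ (pos i))))) ⟩
  suc evens
    ≡⟨ alternation (evenᵇ k) ⟩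
  evens ℕ.+ indicator (not (evenᵇ k)) ℕ.+ indicator (not (evenᵇ (suc k)))
    ≡⟨ cong (ℕ._+ indicator (not (evenᵇ (suc k)))) (odds≡evens+oddity k k≤m) ⟨
  count {m} (λ i → (pos i ≤ᵇ k) ∧ not (evenᵇ (pos i))) ℕ.+ indicator (not (evenᵇ (suc k)))
    ≡⟨ cong (ℕ._+ indicator (not (evenᵇ (suc k))))
            (count-suc {m} (λ i → (pos i ≤ᵇ suc k) ∧ evenᵇ (pos i))) ⟨
  count {suc m} (λ i → (pos i ≤ᵇ suc k) ∧ evenᵇ (pos i)) ℕ.+ indicator (not (evenᵇ (suc k)))
    ∎
  where
  open ≡-Reasoning
  evens : ℕ
  evens = count {m} (λ i → (pos i ≤ᵇ k) ∧ evenᵇ (pos i))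
  alternation : ∀ b → suc evens ≡ evens ℕ.+ indicator (not b) ℕ.+ indicator (not (not b))
  alternation true  = trans (ℕ.+-comm 1 evens) (cong (ℕ._+ 1) (sym (ℕ.+-identityʳ evens)))
  alternation false = sym (trans (ℕ.+-identityʳ (evens ℕ.+ 1)) (ℕ.+-comm evens 1))

any≡unique-witness : ∀ {A : Set} {f : A → Bool} {w : A} {xs : List A} →
  w ∈ xs → (∀ x → T (f x) → x ≡ w) → any f xs ≡ f w
any≡unique-witness {f = f} {w} {xs} w∈xs unique with f w in fw | any f xs in any-f
... | true  | true  = refl
... | false | false = refl
... | true  | false = ⊥-elim (subst T any-f (any⁺ f (lose w∈xs (subst T (sym fw) tt))))
... | false | true  with satisfied (any⁻ f xs (subst T (sym any-f) tt))
...   | x , fx = ⊥-elim (subst T fw (subst (T ∘ f) (unique x fx) fx))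

signedSum : ∀ {A : Set} → (A → Bool) → List A → ℤ
signedSum q xs = sumℤ (map (λ a → if q a then + 1 else - (+ 1)) xs)

signedSum+falls≡rises : ∀ {A : Set} {P : A → Set} {m} (P? : ∀ a → Dec (P a)) (q : A → Bool) (g : Fin m → A) →
  signedSum q (filter P? (tabulate g)) + + count (λ i → ⌊ P? (g i) ⌋ ∧ not (q (g i)))
  ≡ + count (λ i → ⌊ P? (g i) ⌋ ∧ q (g i))
signedSum+falls≡rises {m = zero} P? q g = refl
signedSum+falls≡rises {m = suc m} P? q g
  rewrite count-suc (λ i → ⌊ P? (g i) ⌋ ∧ not (q (g i))) | count-suc (λ i → ⌊ P? (g i) ⌋ ∧ q (g i))
  with P? (g zero)
... | no  _ = signedSum+falls≡rises P? q (g ∘ suc)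
... | yes _ = one-step (q (g zero)) (signedSum q (filter P? (tabulate (g ∘ suc))))
                      (signedSum+falls≡rises P? q (g ∘ suc))
  where
  one-step : ∀ b s {f r} → s + + f ≡ + r →
    (if b then + 1 else - (+ 1)) + s + + (indicator (not b) ℕ.+ f) ≡ + (indicator b ℕ.+ r)
  one-step true  s {f} walk = trans (ℤ.+-assoc (+ 1) s (+ f)) (cong (_+_ (+ 1)) walk)
  one-step false s {f} walk =
    trans (solve 2 (λ s f → (:- con (+ 1) :+ s) :+ (con (+ 1) :+ f) := s :+ f) refl s (+ f)) walk
    where open ℤSolver.+-*-Solver

[2+n]/2≡1+n/2 : ∀ n → (2 ℕ.+ n) / 2 ≡ 1 ℕ.+ n / 2
[2+n]/2≡1+n/2 n = m/n≡1+[m∸n]/n {2 ℕ.+ n} (s≤s (s≤s z≤n))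

ceilHalf-+2 : ∀ x → ceilHalf (x + + 2) ≡ ceilHalf x + + 1
ceilHalf-+2 (+ m) = cong +_ (begin
  (m ℕ.+ 2 ℕ.+ 1) / 2   ≡⟨ cong (_/ 2) (trans (ℕ.+-assoc m 2 1) (sym (ℕ.+-assoc m 1 2))) ⟩
  (m ℕ.+ 1 ℕ.+ 2) / 2   ≡⟨ +-distrib-/-∣ʳ (m ℕ.+ 1) ∣-refl ⟩
  (m ℕ.+ 1) / 2 ℕ.+ 1   ∎)
  where open ≡-Reasoning
ceilHalf-+2 -[1+ 0 ] = refl
ceilHalf-+2 -[1+ 1 ] = refl
ceilHalf-+2 -[1+ suc (suc m) ] = begin
  - (+ (suc m / 2))                   ≡⟨ solve 1 (λ x → :- x := :- (con (+ 1) :+ x) :+ con (+ 1)) refl (+ (suc m / 2)) ⟩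
  - (+ (1 ℕ.+ suc m / 2)) + + 1       ≡⟨ cong (λ q → - (+ q) + + 1) ([2+n]/2≡1+n/2 (suc m)) ⟨
  - (+ (suc (suc (suc m)) / 2)) + + 1 ∎
  where
  open ≡-Reasoning
  open ℤSolver.+-*-Solver

ceilHalf-double : ∀ a → ceilHalf (+ (a ℕ.+ a)) ≡ + a
ceilHalf-double zero = refl
ceilHalf-double (suc a) = begin
  ceilHalf (+ (suc a ℕ.+ suc a)) ≡⟨ cong (ceilHalf ∘ +_) (trans (cong suc (ℕ.+-suc a a)) (ℕ.+-comm 2 _)) ⟩
  ceilHalf (+ (a ℕ.+ a) + + 2)   ≡⟨ ceilHalf-+2 (+ (a ℕ.+ a)) ⟩
  ceilHalf (+ (a ℕ.+ a)) + + 1   ≡⟨ cong (_+ + 1) (ceilHalf-double a) ⟩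
  + (a ℕ.+ 1)                    ≡⟨ cong +_ (ℕ.+-comm a 1) ⟩
  + suc a                        ∎
  where open ≡-Reasoning

module Crossings {m} (σ : Permutation′ m) where

  σ⟨_⟩ : Fin m → ℕ
  σ⟨ i ⟩ = pos (σ ⟨$⟩ʳ i)

  upCrossings downCrossings : ℕ → ℕ
  upCrossings   k = count (λ i → (pos i ≤ᵇ k) ∧ (k <ᵇ σ⟨ i ⟩))
  downCrossings k = count (λ i → (k <ᵇ pos i) ∧ (σ⟨ i ⟩ ≤ᵇ k))

  upCrossings≡downCrossings : ∀ k → upCrossings k ≡ downCrossings k
  upCrossings≡downCrossings k = sym (ℕ.+-cancelˡ-≡ (count below) (downCrossings k) (upCrossings k) (begin
    count below ℕ.+ downCrossings k             ≡⟨ count-+ split-at-source ⟨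
    count either                                ≡⟨ count-+ split-at-image ⟩
    count (below ∘ (σ ⟨$⟩ʳ_)) ℕ.+ upCrossings k ≡⟨ cong (ℕ._+ upCrossings k) (count-permute σ below) ⟩
    count below ℕ.+ upCrossings k               ∎))
    where
    open ≡-Reasoning
    below either : Fin m → Bool
    below i  = pos i ≤ᵇ k
    either i = (pos i ≤ᵇ k) ∨ (σ⟨ i ⟩ ≤ᵇ k)
    split-at-source : ∀ i →
      indicator (either i) ≡ indicator (below i) ℕ.+ indicator ((k <ᵇ pos i) ∧ (σ⟨ i ⟩ ≤ᵇ k))
    split-at-source i rewrite <ᵇ≡not-≤ᵇ k (pos i) = indicator-∨ˡ (pos i ≤ᵇ k) (σ⟨ i ⟩ ≤ᵇ k)
    split-at-image : ∀ i →
      indicator (either i) ≡ indicator (σ⟨ i ⟩ ≤ᵇ k) ℕ.+ indicator ((pos i ≤ᵇ k) ∧ (k <ᵇ σ⟨ i ⟩))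
    split-at-image i rewrite <ᵇ≡not-≤ᵇ k σ⟨ i ⟩ = indicator-∨ʳ (pos i ≤ᵇ k) (σ⟨ i ⟩ ≤ᵇ k)

h+f≡e+u⇒f+u≡1+e⇒h+1≡u+u : ∀ (h : ℤ) falls evens u →
  h + + falls ≡ + (evens ℕ.+ u) → falls ℕ.+ u ≡ suc evens → h + + 1 ≡ + (u ℕ.+ u)
h+f≡e+u⇒f+u≡1+e⇒h+1≡u+u h falls evens u rises odds = begin
  h + + 1
    ≡⟨ solve 3 (λ h f u → h :+ con (+ 1) := (h :+ f) :+ (u :+ con (+ 1)) :- (f :+ u)) refl h (+ falls) (+ u) ⟩
  (h + + falls) + (+ u + + 1) - (+ falls + + u)
    ≡⟨ cong₂ (λ a b → a + (+ u + + 1) - b) rises (cong +_ odds) ⟩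
  + (evens ℕ.+ u) + (+ u + + 1) - + suc evens
    ≡⟨ solve 2 (λ e u → (e :+ u) :+ (u :+ con (+ 1)) :- (con (+ 1) :+ e) := u :+ u) refl (+ evens) (+ u) ⟩
  + (u ℕ.+ u)
    ∎
  where
  open ≡-Reasoning
  open ℤSolver.+-*-Solver

h+f≡r+1⇒h′+f≡r⇒h≡h′+1 : ∀ (h h′ : ℤ) falls rises →
  h + + falls ≡ + (rises ℕ.+ 1) → h′ + + falls ≡ + rises → h ≡ h′ + + 1
h+f≡r+1⇒h′+f≡r⇒h≡h′+1 h h′ falls rises now before = begin
  h                              ≡⟨ solve 2 (λ h f → h := (h :+ f) :- f) refl h (+ falls) ⟩
  (h + + falls) - + falls        ≡⟨ cong (_- + falls) now ⟩
  + rises + + 1 - + falls        ≡⟨ cong (λ r → r + + 1 - + falls) before ⟨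
  (h′ + + falls) + + 1 - + falls ≡⟨ solve 2 (λ h f → (h :+ f) :+ con (+ 1) :- f := h :+ con (+ 1))
                                           refl h′ (+ falls) ⟩
  h′ + + 1                       ∎
  where
  open ≡-Reasoning
  open ℤSolver.+-*-Solver

module DPermutation (n : ℕ) (σ : Permutation′ (2 ℕ.* n)) (isD : IsDPerm n σ) where

  open Crossings σ

  σ≤id-at-even : ∀ j → inF j ≡ true → σ⟨ j ⟩ ≤ pos j
  σ≤id-at-even j = proj₂ (isD j)

  id≤σ-at-odd : ∀ j → inF j ≡ false → pos j ≤ σ⟨ j ⟩
  id≤σ-at-odd j = proj₁ (isD j)

  rises falls evens odds : ℕ → ℕ
  rises k = count (λ i → (pos i ≤ᵇ k) ∧ inF′ n σ i)
  falls k = count (λ i → (pos i ≤ᵇ k) ∧ not (inF′ n σ i))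
  evens k = count {2 ℕ.* n} (λ j → (pos j ≤ᵇ k) ∧ inF j)
  odds  k = count {2 ℕ.* n} (λ j → (pos j ≤ᵇ k) ∧ not (inF j))

  height+falls≡rises : ∀ k → height n σ k + + falls k ≡ + rises k
  height+falls≡rises k = begin
    height n σ k + + falls k
      ≡⟨ cong (λ c → height n σ k + + c) (count-cong {2 ℕ.* n} (λ i → cong (_∧ not (inF′ n σ i)) (prefix i))) ⟨
    height n σ k + + count (λ i → ⌊ pos i ℕ.≤? k ⌋ ∧ not (inF′ n σ i))
      ≡⟨ signedSum+falls≡rises (λ i → pos i ℕ.≤? k) (inF′ n σ) id ⟩
    + count (λ i → ⌊ pos i ℕ.≤? k ⌋ ∧ inF′ n σ i)
      ≡⟨ cong +_ (count-cong {2 ℕ.* n} (λ i → cong (_∧ inF′ n σ i) (prefix i))) ⟩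
    + rises k
      ∎
    where
    open ≡-Reasoning
    prefix : ∀ i → ⌊ pos i ℕ.≤? k ⌋ ≡ (pos i ≤ᵇ k)
    prefix i = isYes≗does (pos i ℕ.≤? k)

  count-by-preimage : ∀ k (c : Bool → Bool) →
    count (λ i → (pos i ≤ᵇ k) ∧ c (inF′ n σ i)) ≡ count (λ j → c (inF j) ∧ (σ⟨ j ⟩ ≤ᵇ k))
  count-by-preimage k c = begin
    count (λ i → (pos i ≤ᵇ k) ∧ c (inF′ n σ i))
      ≡⟨ count-permute σ (λ i → (pos i ≤ᵇ k) ∧ c (inF′ n σ i)) ⟨
    count (λ j → (σ⟨ j ⟩ ≤ᵇ k) ∧ c (evenᵇ (pos (σ ⟨$⟩ˡ (σ ⟨$⟩ʳ j)))))
      ≡⟨ count-cong (λ j → trans (cong (λ i → (σ⟨ j ⟩ ≤ᵇ k) ∧ c (evenᵇ (pos i))) (inverseˡ σ))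
                                 (∧-comm (σ⟨ j ⟩ ≤ᵇ k) (c (inF j)))) ⟩
    count (λ j → c (inF j) ∧ (σ⟨ j ⟩ ≤ᵇ k))
      ∎
    where open ≡-Reasoning

  rises≡evens+downCrossings : ∀ k → rises k ≡ evens k ℕ.+ downCrossings k
  rises≡evens+downCrossings k = trans (count-by-preimage k id) (count-+ pointwise)
    where
    pointwise : ∀ j → indicator (inF j ∧ (σ⟨ j ⟩ ≤ᵇ k))
                    ≡ indicator ((pos j ≤ᵇ k) ∧ inF j) ℕ.+ indicator ((k <ᵇ pos j) ∧ (σ⟨ j ⟩ ≤ᵇ k))
    pointwise j rewrite <ᵇ≡not-≤ᵇ k (pos j) with inF j in parity | pos j ℕ.≤? k
    ... | true  | yes j≤k rewrite ≤ᵇ-true j≤k | ≤ᵇ-true (ℕ.≤-trans (σ≤id-at-even j parity) j≤k) = refl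
    ... | true  | no  j≰k rewrite ≤ᵇ-false (ℕ.≰⇒> j≰k) = refl
    ... | false | yes j≤k rewrite ≤ᵇ-true j≤k = refl
    ... | false | no  j≰k rewrite ≤ᵇ-false (ℕ.≰⇒> j≰k)
                              | ≤ᵇ-false (ℕ.<-≤-trans (ℕ.≰⇒> j≰k) (id≤σ-at-odd j parity)) = refl

  odds≡falls+upCrossings : ∀ k → odds k ≡ falls k ℕ.+ upCrossings k
  odds≡falls+upCrossings k =
    trans (count-+ pointwise) (cong (ℕ._+ upCrossings k) (sym (count-by-preimage k not)))
    where
    pointwise : ∀ j → indicator ((pos j ≤ᵇ k) ∧ not (inF j))
                    ≡ indicator (not (inF j) ∧ (σ⟨ j ⟩ ≤ᵇ k)) ℕ.+ indicator ((pos j ≤ᵇ k) ∧ (k <ᵇ σ⟨ j ⟩))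
    pointwise j rewrite <ᵇ≡not-≤ᵇ k σ⟨ j ⟩ with inF j in parity | pos j ℕ.≤? k
    ... | true  | yes j≤k rewrite ≤ᵇ-true j≤k | ≤ᵇ-true (ℕ.≤-trans (σ≤id-at-even j parity) j≤k) = refl
    ... | true  | no  j≰k rewrite ≤ᵇ-false (ℕ.≰⇒> j≰k) = refl
    ... | false | yes j≤k rewrite ≤ᵇ-true j≤k with σ⟨ j ⟩ ≤ᵇ k
    ...   | true  = refl
    ...   | false = refl
    pointwise j | false | no j≰k rewrite ≤ᵇ-false (ℕ.≰⇒> j≰k)
                                     | ≤ᵇ-false (ℕ.<-≤-trans (ℕ.≰⇒> j≰k) (id≤σ-at-odd j parity)) = refl

  height-at-odd : ∀ k → k ≤ 2 ℕ.* n → not (evenᵇ k) ≡ true →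
    height n σ k + + 1 ≡ + (upCrossings k ℕ.+ upCrossings k)
  height-at-odd k k≤2n k-odd = h+f≡e+u⇒f+u≡1+e⇒h+1≡u+u (height n σ k) (falls k) (evens k) (upCrossings k)
    (trans (height+falls≡rises k)
      (cong +_ (trans (rises≡evens+downCrossings k) (cong (evens k ℕ.+_) (sym (upCrossings≡downCrossings k))))))
    (begin
      falls k ℕ.+ upCrossings k             ≡⟨ odds≡falls+upCrossings k ⟨
      odds k                                ≡⟨ odds≡evens+oddity k k≤2n ⟩
      evens k ℕ.+ indicator (not (evenᵇ k)) ≡⟨ cong (λ b → evens k ℕ.+ indicator b) k-odd ⟩
      evens k ℕ.+ 1                         ≡⟨ ℕ.+-comm (evens k) 1 ⟩
      suc (evens k)                         ∎)
    where open ≡-Reasoning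

  height-after-rise : ∀ y → inF′ n σ y ≡ true → height n σ (pos y) ≡ height n σ (toℕ y) + + 1
  height-after-rise y rise =
    h+f≡r+1⇒h′+f≡r⇒h≡h′+1 (height n σ (pos y)) (height n σ (toℕ y)) (falls (toℕ y)) (rises (toℕ y))
      at-y (height+falls≡rises (toℕ y))
    where
    falls-unchanged : falls (pos y) ≡ falls (toℕ y)
    falls-unchanged = trans (count-prefix-step (not ∘ inF′ n σ) y)
      (trans (cong (λ b → falls (toℕ y) ℕ.+ indicator (not b)) rise) (ℕ.+-identityʳ _))
    rises-grow : rises (pos y) ≡ rises (toℕ y) ℕ.+ 1
    rises-grow = trans (count-prefix-step (inF′ n σ) y) (cong (λ b → rises (toℕ y) ℕ.+ indicator b) rise)
    at-y : height n σ (pos y) + + falls (toℕ y) ≡ + (rises (toℕ y) ℕ.+ 1)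
    at-y = subst₂ (λ f r → height n σ (pos y) + + f ≡ + r) falls-unchanged rises-grow (height+falls≡rises (pos y))

  inLaterPreimages≡inF∧y<σ : ∀ y u → inLaterPreimages n σ y u ≡ inF u ∧ (pos y <ᵇ σ⟨ u ⟩)
  inLaterPreimages≡inF∧y<σ y u = begin
    inLaterPreimages n σ y u
      ≡⟨ any≡unique-witness (∈-allFin (σ ⟨$⟩ʳ u)) preimage-of-u ⟩
    inF′ n σ (σ ⟨$⟩ʳ u) ∧ (pos y <ᵇ σ⟨ u ⟩) ∧ ⌊ σ ⟨$⟩ˡ (σ ⟨$⟩ʳ u) ≟ u ⌋
      ≡⟨ cong (λ i → evenᵇ (pos i) ∧ (pos y <ᵇ σ⟨ u ⟩) ∧ ⌊ i ≟ u ⌋) (inverseˡ σ) ⟩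
    inF u ∧ (pos y <ᵇ σ⟨ u ⟩) ∧ ⌊ u ≟ u ⌋
      ≡⟨ cong (λ b → inF u ∧ (pos y <ᵇ σ⟨ u ⟩) ∧ b) (trans (isYes≗does (u ≟ u)) (dec-true (u ≟ u) refl)) ⟩
    inF u ∧ (pos y <ᵇ σ⟨ u ⟩) ∧ true
      ≡⟨ cong (inF u ∧_) (∧-identityʳ _) ⟩
    inF u ∧ (pos y <ᵇ σ⟨ u ⟩)
      ∎
    where
    open ≡-Reasoning
    preimage-of-u : ∀ y′ → T (inF′ n σ y′ ∧ (pos y <ᵇ pos y′) ∧ ⌊ σ ⟨$⟩ˡ y′ ≟ u ⌋) → y′ ≡ σ ⟨$⟩ʳ u
    preimage-of-u y′ chosen with inF′ n σ y′ | pos y <ᵇ pos y′ | σ ⟨$⟩ˡ y′ ≟ u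
    ... | true | true | yes σ⁻¹y′≡u = trans (sym (inverseʳ σ)) (cong (σ ⟨$⟩ʳ_) σ⁻¹y′≡u)

  lhsCount≡downCrossings : ∀ y → lhsCount n σ y ≡ downCrossings (pos y)
  lhsCount≡downCrossings y = count-cong {2 ℕ.* n} pointwise
    where
    k : ℕ
    k = pos y
    pointwise : ∀ u →
      inF u ∧ not (inLaterPreimages n σ y u) ∧ (k <ᵇ pos u) ≡ (k <ᵇ pos u) ∧ (σ⟨ u ⟩ ≤ᵇ k)
    pointwise u rewrite inLaterPreimages≡inF∧y<σ y u | <ᵇ≡not-≤ᵇ k (pos u) | <ᵇ≡not-≤ᵇ k σ⟨ u ⟩
      with inF u in parity
    ... | true = trans (cong (_∧ not (pos u ≤ᵇ k)) (not-involutive (σ⟨ u ⟩ ≤ᵇ k)))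
                       (∧-comm (σ⟨ u ⟩ ≤ᵇ k) (not (pos u ≤ᵇ k)))
    ... | false with pos u ℕ.≤? k
    ...   | yes u≤k rewrite ≤ᵇ-true u≤k = refl
    ...   | no  u≰k rewrite ≤ᵇ-false (ℕ.≰⇒> u≰k)
                          | ≤ᵇ-false (ℕ.<-≤-trans (ℕ.≰⇒> u≰k) (id≤σ-at-odd u parity)) = refl

lemma7p16 : (n : ℕ) (σ : Permutation′ (2 Data.Nat.* n)) → IsDPerm n σ →
    (y : Fin (2 Data.Nat.* n)) → inG y ≡ true → inF′ n σ y ≡ true →
    (+ lhsCount n σ y ≡ ceilHalf (height n σ (toℕ y)) + + 1)
    × (ceilHalf (height n σ (toℕ y)) + + 1 ≡ ceilHalf (height n σ (pos y) + + 1))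
    × (ceilHalf (height n σ (pos y) + + 1) ≡ + fcount n σ (pos y))
lemma7p16 n σ isD y y∈G y∈F′ = lhs≡middle , middle≡rhs , rhs≡f
  where
  open Crossings σ
  open DPermutation n σ isD
  h h′ : ℤ
  h  = height n σ (pos y)
  h′ = height n σ (toℕ y)
  rhs≡f : ceilHalf (h + + 1) ≡ + fcount n σ (pos y)
  rhs≡f = trans (cong ceilHalf (height-at-odd (pos y) (Fin.toℕ<n y) y∈G)) (ceilHalf-double _)
  middle≡rhs : ceilHalf h′ + + 1 ≡ ceilHalf (h + + 1)
  middle≡rhs = trans (sym (ceilHalf-+2 h′))
    (cong ceilHalf (trans (sym (ℤ.+-assoc h′ (+ 1) (+ 1))) (cong (_+ + 1) (sym (height-after-rise y y∈F′)))))
  lhs≡middle : + lhsCount n σ y ≡ ceilHalf h′ + + 1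
  lhs≡middle = trans (cong +_ (trans (lhsCount≡downCrossings y) (sym (upCrossings≡downCrossings (pos y)))))
                     (sym (trans middle≡rhs rhs≡f))
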